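{- For every finite simple graph $G$ (with at least one vertex), $$\alpha(G)\geq \sum_{v\in V(G)} \frac{1}{\zeta(v)+1}.$$
   Context: $\alpha(G)$ is the maximum cardinality of an independent set in $G$. For a vertex $v$, $\zeta(v)=\max_H \delta(H)$, the maximum over all subgraphs $H$ of $G$ containing $v$, where $\delta(H)$ is the minimum degree of $H$. -}

module Defs where

open import Data.Nat using (ℕ; zero; suc; _≤_)
open import Data.Fin using (Fin)
open import Data.Fin.Subset using (Subset; _∈_; ∣_∣)
open import Data.List using (List; length; filter; foldr)
open import Data.List.Base using (allFin)
open import Data.Product using (Σ; _×_; ∃; ∃-syntax)
open import Data.Integer using (+_)
open import Data.Rational using (ℚ; 0ℚ; _/_) renaming (_+_ to _+ℚ_)
open import Relation.Nullary using (¬_; Dec)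
open import Relation.Binary.PropositionalEquality using (_≡_)

record Graph (n : ℕ) : Set₁ where
  field
    Adj    : Fin n → Fin n → Set
    adj?   : ∀ u v → Dec (Adj u v)
    sym    : ∀ {u v} → Adj u v → Adj v u
    irrefl : ∀ {v} → ¬ Adj v v
open Graph public

record Subgraph {n : ℕ} (G : Graph n) : Set₁ where
  field
    V      : Subset n
    E      : Fin n → Fin n → Set
    E?     : ∀ u v → Dec (E u v)
    E-sym  : ∀ {u v} → E u v → E v u
    E⊆Adj  : ∀ {u v} → E u v → Adj G u v
    E-endˡ : ∀ {u v} → E u v → u ∈ V
open Subgraph public

degree : ∀ {n} {G : Graph n} → Subgraph G → Fin n → ℕ
degree {n} H w = length (filter (E? H w) (allFin n))

MinDegree : ∀ {n} {G : Graph n} → Subgraph G → ℕ → Set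
MinDegree {n} H d =
  (∃[ w ] (w ∈ V H × degree H w ≡ d)) × (∀ w → w ∈ V H → d ≤ degree H w)

IsZeta : ∀ {n} (G : Graph n) → Fin n → ℕ → Set₁
IsZeta G v z =
  (Σ (Subgraph G) λ H → v ∈ V H × MinDegree H z)
  × (∀ (H : Subgraph G) d → v ∈ V H → MinDegree H d → d ≤ z)

Independent : ∀ {n} → Graph n → Subset n → Set
Independent G S = ∀ u v → u ∈ S → v ∈ S → ¬ Adj G u v

IsAlpha : ∀ {n} → Graph n → ℕ → Set
IsAlpha {n} G a =
  (∃[ S ] (Independent G S × ∣ S ∣ ≡ a))
  × (∀ (S : Subset n) → Independent G S → ∣ S ∣ ≤ a)

sumInv : ∀ {n} → (Fin n → ℕ) → ℚ
sumInv {n} f = foldr (λ v acc → ((+ 1) / suc (f v)) +ℚ acc) 0ℚ (allFin n)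

-- Pick a vertex v of minimum degree d in the subgraph induced by the remaining
-- vertices S; that subgraph contains every u ∈ S and has minimum degree d, so ζ(u) ≥ d. Hence the
-- at most d + 1 vertices of the closed neighbourhood of v in S carry weight 1/(ζ(u)+1) ≤ 1/(d+1)
-- each, at most 1 in total. Put v into the independent set, delete its closed neighbourhood from
-- S, and repeat: every vertex added pays for at most one unit of the weight sum.
module Submission where

open import Defs
open import Data.Fin using (Fin; zero; suc)
open import Data.Fin.Subset
  using (Subset; inside; outside; _∈_; _∉_; _⊆_; _⊂_; ∣_∣; _∩_; _∪_; _─_; ⁅_⁆; ⊤; Nonempty)
open import Data.Fin.Subset.Properties
open import Data.Integer using (+_)
open import Data.Nat using (ℕ; zero; suc)
open import Data.Product using (_×_; _,_; proj₁; proj₂; ∃-syntax)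
open import Data.Sum using (inj₁; inj₂)
open import Data.Vec using ([]; _∷_; here; there)
open import Function using (_∘_; id)
open import Level using (Level)
open import Relation.Binary.PropositionalEquality as ≡ using (_≡_; refl; cong; cong₂)
open import Relation.Nullary using (¬_; yes; no; does; contradiction)
open import Relation.Unary using (Pred; Decidable)

private variable
  ℓ : Level
  n : ℕ

module SubsetProperties where

  open import Data.Nat using (_+_; _≤_; _<_; z≤n; s≤s)
  open import Data.Nat.Properties using (≤-trans; ≤-reflexive; +-monoʳ-≤; +-suc)
  open import Data.List using (length; filter; allFin)
  import Data.List as List
  open import Data.List.Extrema.Nat using (argmin; argmin-all; f[argmin]≤f[xs])
  open import Data.List.Membership.Propositional.Properties using (∈-filter⁺; ∈-allFin)
  import Data.List.Relation.Unary.All as All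
  open import Data.List.Relation.Unary.All.Properties using (all-filter)
  open import Data.Vec using (tabulate)

  ⟦_⟧ : {P : Pred (Fin n) ℓ} → Decidable P → Subset n
  ⟦ P? ⟧ = tabulate (does ∘ P?)

  ∈⟦⟧⁺ : {P : Pred (Fin n) ℓ} (P? : Decidable P) {x : Fin n} → P x → x ∈ ⟦ P? ⟧
  ∈⟦⟧⁺ {suc n} P? {zero} px with P? zero
  ... | yes _  = here
  ... | no ¬px = contradiction px ¬px
  ∈⟦⟧⁺ {suc n} P? {suc x} px = there (∈⟦⟧⁺ (P? ∘ suc) px)

  ∈⟦⟧⁻ : {P : Pred (Fin n) ℓ} (P? : Decidable P) {x : Fin n} → x ∈ ⟦ P? ⟧ → P x
  ∈⟦⟧⁻ {suc n} P? {zero} x∈ with P? zero | x∈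
  ... | yes px | _ = px
  ∈⟦⟧⁻ {suc n} P? {suc x} (there x∈) = ∈⟦⟧⁻ (P? ∘ suc) x∈

  ∣⟦⟧∣≡length-filter : {P : Pred (Fin n) ℓ} (P? : Decidable P) →
    ∣ ⟦ P? ⟧ ∣ ≡ length (filter P? (allFin n))
  ∣⟦⟧∣≡length-filter P? = ∣tabulate∣≡length-filter-tabulate P? id
    where
    ∣tabulate∣≡length-filter-tabulate : ∀ {a m} {A : Set a} {P : Pred A ℓ} (P? : Decidable P)
      (f : Fin m → A) → ∣ tabulate (does ∘ P? ∘ f) ∣ ≡ length (filter P? (List.tabulate f))
    ∣tabulate∣≡length-filter-tabulate {m = zero}  P? f = refl
    ∣tabulate∣≡length-filter-tabulate {m = suc m} P? f with P? (f zero)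
    ... | yes _ = cong suc (∣tabulate∣≡length-filter-tabulate P? (f ∘ suc))
    ... | no _  = ∣tabulate∣≡length-filter-tabulate P? (f ∘ suc)

  ∣p∪q∣≤∣p∣+∣q∣ : ∀ (p q : Subset n) → ∣ p ∪ q ∣ ≤ ∣ p ∣ + ∣ q ∣
  ∣p∪q∣≤∣p∣+∣q∣ []            []            = z≤n
  ∣p∪q∣≤∣p∣+∣q∣ (inside  ∷ p) (s ∷ q)       =
    s≤s (≤-trans (∣p∪q∣≤∣p∣+∣q∣ p q) (+-monoʳ-≤ ∣ p ∣ (∣p∣≤∣x∷p∣ s q)))
  ∣p∪q∣≤∣p∣+∣q∣ (outside ∷ p) (inside  ∷ q) =
    ≤-trans (s≤s (∣p∪q∣≤∣p∣+∣q∣ p q)) (≤-reflexive (≡.sym (+-suc ∣ p ∣ ∣ q ∣)))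
  ∣p∪q∣≤∣p∣+∣q∣ (outside ∷ p) (outside ∷ q) = ∣p∪q∣≤∣p∣+∣q∣ p q

  x∈p─q⇒x∉q : ∀ {x : Fin n} {p q} → x ∈ p ─ q → x ∉ q
  x∈p─q⇒x∉q {p = inside ∷ p} {outside ∷ q} here       ()
  x∈p─q⇒x∉q {p = _      ∷ p} {_       ∷ q} (there x∈) (there x∈q) = x∈p─q⇒x∉q x∈ x∈q

  x∉p⇒∣p∣<∣⁅x⁆∪p∣ : ∀ {x : Fin n} {p} → x ∉ p → ∣ p ∣ < ∣ ⁅ x ⁆ ∪ p ∣
  x∉p⇒∣p∣<∣⁅x⁆∪p∣ {x = x} {p} x∉p =
    p⊂q⇒∣p∣<∣q∣ (q⊆p∪q ⁅ x ⁆ p , x , x∈p∪q⁺ (inj₁ (x∈⁅x⁆ x)) , x∉p)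

  argmin-∈ : (f : Fin n → ℕ) {p : Subset n} → Nonempty p →
    ∃[ v ] (v ∈ p × ∀ {x} → x ∈ p → f v ≤ f x)
  argmin-∈ f {p} (v₀ , v₀∈p) =
    argmin f v₀ xs ,
    argmin-all f v₀∈p (all-filter (_∈? p) (allFin _)) ,
    λ x∈p → All.lookup (f[argmin]≤f[xs] v₀ xs) (∈-filter⁺ (_∈? p) (∈-allFin _) x∈p)
    where xs = filter (_∈? p) (allFin _)

open SubsetProperties

module Weights where

  open import Data.Nat as ℕ using ()
  open import Data.Integer as ℤ using (+≤+)
  import Data.Integer.Properties as ℤ
  import Data.Integer.Tactic.RingSolver as ℤ-Solver
  open import Data.Rational.Unnormalised using (ℚᵘ; mkℚᵘ; 0ℚᵘ; 1ℚᵘ; *≡*; *≤*; _+_; _≤_; _≃_)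
  open import Data.Rational.Unnormalised.Properties
    using (≃-refl; ≃-trans; ≤-trans; ≤-reflexive; +-cong; +-mono-≤; +-assoc-≡; +-comm-≡; +-identityˡ-≡)
  import Data.Rational as ℚ
  import Data.Rational.Properties as ℚ
  open import Data.List using (foldr)
  import Data.List as List
  open import Relation.Binary.PropositionalEquality using (subst₂)

  -- mkℚᵘ (+ a) d is the fraction a / (d + 1).

  +-mkℚᵘ : ∀ a b d → mkℚᵘ (+ a) d + mkℚᵘ (+ b) d ≃ mkℚᵘ (+ (a ℕ.+ b)) d
  +-mkℚᵘ a b d = *≡* (≡.trans (factor (+ a) (+ b) (+ suc d))
    (cong₂ ℤ._*_ (≡.sym (ℤ.pos-+ a b)) (≡.sym (ℤ.pos-* (suc d) (suc d)))))
    where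
    factor : ∀ x y z → (x ℤ.* z ℤ.+ y ℤ.* z) ℤ.* z ≡ (x ℤ.+ y) ℤ.* (z ℤ.* z)
    factor = ℤ-Solver.solve-∀

  mkℚᵘ-monoˡ-≤ : ∀ {a b} d → a ℕ.≤ b → mkℚᵘ (+ a) d ≤ mkℚᵘ (+ b) d
  mkℚᵘ-monoˡ-≤ d a≤b = *≤* (ℤ.*-monoʳ-≤-nonNeg (+ suc d) (+≤+ a≤b))

  mkℚᵘ-antimonoʳ-≤ : ∀ {d e} → d ℕ.≤ e → mkℚᵘ (+ 1) e ≤ mkℚᵘ (+ 1) d
  mkℚᵘ-antimonoʳ-≤ {d} {e} d≤e = *≤* (subst₂ ℤ._≤_
    (≡.sym (ℤ.*-identityˡ (+ suc d))) (≡.sym (ℤ.*-identityˡ (+ suc e))) (+≤+ (ℕ.s≤s d≤e)))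

  mkℚᵘ-≤-1 : ∀ {a} d → a ℕ.≤ suc d → mkℚᵘ (+ a) d ≤ 1ℚᵘ
  mkℚᵘ-≤-1 {a} d a≤1+d = *≤* (subst₂ ℤ._≤_
    (≡.sym (ℤ.*-identityʳ (+ a))) (≡.sym (ℤ.*-identityˡ (+ suc d))) (+≤+ a≤1+d))

  weight : (Fin n → ℚᵘ) → Subset n → ℚᵘ
  weight w []            = 0ℚᵘ
  weight w (inside  ∷ p) = w zero + weight (w ∘ suc) p
  weight w (outside ∷ p) = weight (w ∘ suc) p

  weight-∩-─ : ∀ (w : Fin n → ℚᵘ) p q → weight w p ≡ weight w (p ∩ q) + weight w (p ─ q)
  weight-∩-─ w []            []            = ≡.sym (+-identityˡ-≡ 0ℚᵘ)
  weight-∩-─ w (inside  ∷ p) (inside  ∷ q) = begin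
    w zero + weight (w ∘ suc) p   ≡⟨ cong (λ s → w zero + s) (weight-∩-─ (w ∘ suc) p q) ⟩
    w zero + (A + B)              ≡⟨ ≡.sym (+-assoc-≡ (w zero) A B) ⟩
    w zero + A + B                ∎
    where
    open ≡.≡-Reasoning
    A = weight (w ∘ suc) (p ∩ q)
    B = weight (w ∘ suc) (p ─ q)
  weight-∩-─ w (inside  ∷ p) (outside ∷ q) = begin
    w zero + weight (w ∘ suc) p   ≡⟨ cong (λ s → w zero + s) (weight-∩-─ (w ∘ suc) p q) ⟩
    w zero + (A + B)              ≡⟨ ≡.sym (+-assoc-≡ (w zero) A B) ⟩
    w zero + A + B                ≡⟨ cong (_+ B) (+-comm-≡ (w zero) A) ⟩
    A + w zero + B                ≡⟨ +-assoc-≡ A (w zero) B ⟩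
    A + (w zero + B)              ∎
    where
    open ≡.≡-Reasoning
    A = weight (w ∘ suc) (p ∩ q)
    B = weight (w ∘ suc) (p ─ q)
  weight-∩-─ w (outside ∷ p) (inside  ∷ q) = weight-∩-─ (w ∘ suc) p q
  weight-∩-─ w (outside ∷ p) (outside ∷ q) = weight-∩-─ (w ∘ suc) p q

  weight-≤-∣∣ : ∀ {w : Fin n → ℚᵘ} d p → (∀ {x} → x ∈ p → w x ≤ mkℚᵘ (+ 1) d) →
    weight w p ≤ mkℚᵘ (+ ∣ p ∣) d
  weight-≤-∣∣ d []            _  = ≤-reflexive (*≡* refl)
  weight-≤-∣∣ d (inside  ∷ p) w≤ = ≤-trans
    (+-mono-≤ (w≤ here) (weight-≤-∣∣ d p (w≤ ∘ there))) (≤-reflexive (+-mkℚᵘ 1 ∣ p ∣ d))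
  weight-≤-∣∣ d (outside ∷ p) w≤ = weight-≤-∣∣ d p (w≤ ∘ there)

  toℚᵘ-sumInv : (ζ : Fin n → ℕ) → ℚ.toℚᵘ (sumInv ζ) ≃ weight (λ u → mkℚᵘ (+ 1) (ζ u)) ⊤
  toℚᵘ-sumInv {n} ζ = toℚᵘ-foldr-tabulate id
    where
    toℚᵘ-foldr-tabulate : ∀ {m} (f : Fin m → Fin n) →
      ℚ.toℚᵘ (foldr (λ v acc → ((+ 1) ℚ./ suc (ζ v)) ℚ.+ acc) ℚ.0ℚ (List.tabulate f))
        ≃ weight (λ u → mkℚᵘ (+ 1) (ζ (f u))) ⊤
    toℚᵘ-foldr-tabulate {zero}  f = ≃-refl
    toℚᵘ-foldr-tabulate {suc m} f = ≃-trans
      (ℚ.toℚᵘ-homo-+ (ℚ.fromℚᵘ (mkℚᵘ (+ 1) (ζ (f zero))))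
                     (foldr (λ v acc → ((+ 1) ℚ./ suc (ζ v)) ℚ.+ acc) ℚ.0ℚ (List.tabulate (f ∘ suc))))
      (+-cong (ℚ.toℚᵘ-fromℚᵘ (mkℚᵘ (+ 1) (ζ (f zero)))) (toℚᵘ-foldr-tabulate (f ∘ suc)))

open Weights

module Neighbourhoods {n : ℕ} (G : Graph n) where

  open import Data.Nat using (_+_; _≤_)
  open import Data.Nat.Properties using (module ≤-Reasoning)
  open import Relation.Nullary using (_×-dec_)

  N[_] : Fin n → Subset n
  N[ v ] = ⁅ v ⁆ ∪ ⟦ adj? G v ⟧

  v∈N[v] : ∀ v → v ∈ N[ v ]
  v∈N[v] v = x∈p∪q⁺ (inj₁ (x∈⁅x⁆ v))

  S─N[v]⊂S : ∀ {S v} → v ∈ S → S ─ N[ v ] ⊂ S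
  S─N[v]⊂S {S} {v} v∈S = p∩q≢∅⇒p─q⊂p S N[ v ] (v , x∈p∩q⁺ (v∈S , v∈N[v] v))

  x∉N[v]⇒¬Adj : ∀ {v x} → x ∉ N[ v ] → ¬ Adj G v x
  x∉N[v]⇒¬Adj {v} x∉ vx = x∉ (x∈p∪q⁺ (inj₂ (∈⟦⟧⁺ (adj? G v) vx)))

  Independent-⁅⁆∪ : ∀ {v I} → Independent G I → (∀ {x} → x ∈ I → ¬ Adj G v x) →
    Independent G (⁅ v ⁆ ∪ I)
  Independent-⁅⁆∪ {v} {I} ind v≁I x y x∈ y∈
    with x∈p∪q⁻ ⁅ v ⁆ I x∈ | x∈p∪q⁻ ⁅ v ⁆ I y∈
  ... | inj₁ x∈⁅v⁆ | inj₁ y∈⁅v⁆ rewrite x∈⁅y⁆⇒x≡y v x∈⁅v⁆ | x∈⁅y⁆⇒x≡y v y∈⁅v⁆ = irrefl G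
  ... | inj₁ x∈⁅v⁆ | inj₂ y∈I   rewrite x∈⁅y⁆⇒x≡y v x∈⁅v⁆ = v≁I y∈I
  ... | inj₂ x∈I   | inj₁ y∈⁅v⁆ rewrite x∈⁅y⁆⇒x≡y v y∈⁅v⁆ = v≁I x∈I ∘ sym G
  ... | inj₂ x∈I   | inj₂ y∈I   = ind x y x∈I y∈I

  induced : Subset n → Subgraph G
  induced S = record
    { V      = S
    ; E      = λ u w → u ∈ S × w ∈ S × Adj G u w
    ; E?     = λ u w → (u ∈? S) ×-dec (w ∈? S) ×-dec adj? G u w
    ; E-sym  = λ (u∈S , w∈S , uw) → w∈S , u∈S , sym G uw
    ; E⊆Adj  = proj₂ ∘ proj₂
    ; E-endˡ = proj₁
    }

  ∣S∩N[v]∣≤1+degree : ∀ {S v} → v ∈ S → ∣ S ∩ N[ v ] ∣ ≤ suc (degree (induced S) v)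
  ∣S∩N[v]∣≤1+degree {S} {v} v∈S = begin
    ∣ S ∩ N[ v ] ∣                       ≤⟨ p⊆q⇒∣p∣≤∣q∣ S∩N[v]⊆ ⟩
    ∣ ⁅ v ⁆ ∪ nbrs ∣                      ≤⟨ ∣p∪q∣≤∣p∣+∣q∣ ⁅ v ⁆ nbrs ⟩
    ∣ ⁅ v ⁆ ∣ + ∣ nbrs ∣                  ≡⟨ cong₂ _+_ (∣⁅x⁆∣≡1 v) (∣⟦⟧∣≡length-filter (E? (induced S) v)) ⟩
    suc (degree (induced S) v)           ∎
    where
    open ≤-Reasoning
    nbrs = ⟦ E? (induced S) v ⟧
    S∩N[v]⊆ : S ∩ N[ v ] ⊆ ⁅ v ⁆ ∪ nbrs
    S∩N[v]⊆ x∈ with x∈p∩q⁻ S N[ v ] x∈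
    ... | x∈S , x∈N[v] with x∈p∪q⁻ ⁅ v ⁆ ⟦ adj? G v ⟧ x∈N[v]
    ...   | inj₁ x∈⁅v⁆ = x∈p∪q⁺ (inj₁ x∈⁅v⁆)
    ...   | inj₂ x∈adj = x∈p∪q⁺ (inj₂ (∈⟦⟧⁺ (E? (induced S) v) (v∈S , x∈S , ∈⟦⟧⁻ (adj? G v) x∈adj)))

  minimum-degree-vertex : ∀ {S} → Nonempty S →
    ∃[ v ] (v ∈ S × MinDegree (induced S) (degree (induced S) v))
  minimum-degree-vertex ne with argmin-∈ (degree (induced _)) ne
  ... | v , v∈S , minimal = v , v∈S , (v , v∈S , refl) , λ _ x∈S → minimal x∈S

module Greedy {n : ℕ} (G : Graph n) where

  open import Data.Rational.Unnormalised using (ℚᵘ; mkℚᵘ; 1ℚᵘ; _+_; _≤_)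
  open import Data.Rational.Unnormalised.Properties
    using (≤-trans; +-mono-≤; module ≤-Reasoning)
  open import Data.Nat as ℕ using ()
  open import Data.Fin.Subset.Induction using (Acc; acc; ⊂-wellFounded)
  open Neighbourhoods G

  greedy-independent-set : (w : Fin n → ℚᵘ) →
    (∀ S → Nonempty S → ∃[ v ] (v ∈ S × weight w (S ∩ N[ v ]) ≤ 1ℚᵘ)) →
    ∀ S → ∃[ I ] (I ⊆ S × Independent G I × weight w S ≤ mkℚᵘ (+ ∣ I ∣) 0)
  greedy-independent-set w sparse S = go S (⊂-wellFounded S)
    where
    go : ∀ S → Acc _⊂_ S → ∃[ I ] (I ⊆ S × Independent G I × weight w S ≤ mkℚᵘ (+ ∣ I ∣) 0)
    go S (acc rec) with nonempty? S
    ... | no empty = S , id , (λ x _ x∈S _ → contradiction (x , x∈S) empty) ,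
                     weight-≤-∣∣ 0 S (λ x∈S → contradiction (_ , x∈S) empty)
    ... | yes ne with sparse S ne
    ... | v , v∈S , N[v]≤1 with go (S ─ N[ v ]) (rec (S─N[v]⊂S v∈S))
    ... | I , I⊆S─N[v] , I-independent , S─N[v]≤∣I∣ =
      ⁅ v ⁆ ∪ I , ⁅v⁆∪I⊆S , Independent-⁅⁆∪ I-independent (x∉N[v]⇒¬Adj ∘ ∉N[v]) , bound
      where
      ∉N[v] : ∀ {x} → x ∈ I → x ∉ N[ v ]
      ∉N[v] = x∈p─q⇒x∉q ∘ I⊆S─N[v]

      v∉I : v ∉ I
      v∉I v∈I = ∉N[v] v∈I (v∈N[v] v)

      ⁅v⁆∪I⊆S : ⁅ v ⁆ ∪ I ⊆ S
      ⁅v⁆∪I⊆S x∈ with x∈p∪q⁻ ⁅ v ⁆ I x∈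
      ... | inj₁ x∈⁅v⁆ rewrite x∈⁅y⁆⇒x≡y v x∈⁅v⁆ = v∈S
      ... | inj₂ x∈I   = p─q⊆p S N[ v ] (I⊆S─N[v] x∈I)

      bound : weight w S ≤ mkℚᵘ (+ ∣ ⁅ v ⁆ ∪ I ∣) 0
      bound = begin
        weight w S                                  ≡⟨ weight-∩-─ w S N[ v ] ⟩
        weight w (S ∩ N[ v ]) + weight w (S ─ N[ v ]) ≤⟨ +-mono-≤ N[v]≤1 S─N[v]≤∣I∣ ⟩
        1ℚᵘ + mkℚᵘ (+ ∣ I ∣) 0                       ≃⟨ +-mkℚᵘ 1 ∣ I ∣ 0 ⟩
        mkℚᵘ (+ suc ∣ I ∣) 0                        ≤⟨ mkℚᵘ-monoˡ-≤ 0 (x∉p⇒∣p∣<∣⁅x⁆∪p∣ v∉I) ⟩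
        mkℚᵘ (+ ∣ ⁅ v ⁆ ∪ I ∣) 0                     ∎
        where open ≤-Reasoning

  closed-neighbourhood-weight-≤-1 : (ζ : Fin n → ℕ) → (∀ v → IsZeta G v (ζ v)) →
    ∀ S → Nonempty S → ∃[ v ] (v ∈ S × weight (λ u → mkℚᵘ (+ 1) (ζ u)) (S ∩ N[ v ]) ≤ 1ℚᵘ)
  closed-neighbourhood-weight-≤-1 ζ isζ S ne with minimum-degree-vertex ne
  ... | v , v∈S , min-degree = v , v∈S , ≤-trans
    (weight-≤-∣∣ d (S ∩ N[ v ]) (mkℚᵘ-antimonoʳ-≤ ∘ d≤ζ ∘ proj₁ ∘ x∈p∩q⁻ S N[ v ]))
    (mkℚᵘ-≤-1 d (∣S∩N[v]∣≤1+degree v∈S))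
    where
    d = degree (induced S) v
    d≤ζ : ∀ {x} → x ∈ S → d ℕ.≤ ζ x
    d≤ζ {x} x∈S = proj₂ (isζ x) (induced S) d x∈S min-degree

open Greedy

open import Data.Rational using (_≤_; _/_; toℚᵘ)
open import Data.Rational.Properties using (toℚᵘ-cancel-≤; toℚᵘ-fromℚᵘ)
open import Data.Rational.Unnormalised using (ℚᵘ; mkℚᵘ)
open import Data.Rational.Unnormalised.Properties using (≃-sym; module ≤-Reasoning)

theorem1 : (n : ℕ) (G : Graph (suc n)) (a : ℕ) (ζ : Fin (suc n) → ℕ) →
    IsAlpha G a → (∀ v → IsZeta G v (ζ v)) →
    sumInv ζ ≤ (+ a) / 1
theorem1 n G a ζ (_ , α-maximal) isζ =
  let I , _ , I-independent , weight≤∣I∣ =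
        greedy-independent-set G w (closed-neighbourhood-weight-≤-1 G ζ isζ) ⊤
  in toℚᵘ-cancel-≤ (begin
       toℚᵘ (sumInv ζ)    ≃⟨ toℚᵘ-sumInv ζ ⟩
       weight w ⊤         ≤⟨ weight≤∣I∣ ⟩
       mkℚᵘ (+ ∣ I ∣) 0    ≤⟨ mkℚᵘ-monoˡ-≤ 0 (α-maximal I I-independent) ⟩
       mkℚᵘ (+ a) 0       ≃⟨ ≃-sym (toℚᵘ-fromℚᵘ (mkℚᵘ (+ a) 0)) ⟩
       toℚᵘ ((+ a) / 1)   ∎)
  where
  open ≤-Reasoning
  w : Fin (suc n) → ℚᵘ
  w u = mkℚᵘ (+ 1) (ζ u)
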